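{- Let $k\ge 3$, $n\ge k$ and $L\ge 0$ be integers. Let $P_{n,L}(k\text{ -XOR-SAT})$ denote the probability that a random $k$-XOR-formula drawn uniformly from $\Omega(n,L,k)$ is satisfiable. Let $A$ be chosen uniformly at random from the set $M_{L,n,k}$ of Boolean $L\times n$ matrices having exactly $k$ entries equal to $1$ in each row, let $Y(A)$ denote the number of vectors in the kernel of the transpose $A^{T}$ (over $GF(2)$), and for $0\le r\le L$ let $P_{(r)}$ be the probability that $A$ has rank $r$ over $GF(2)$. Then $$P_{n,L}(k\text{ -XOR-SAT})=\sum_{r=0}^{L}2^{r-L}P_{(r)}=E_{L,k}(1/Y),$$ where $E_{L,k}$ denotes expectation with respect to the uniform choice of $A\in M_{L,n,k}$.
   Context: A $k$-XOR-clause over the variables $x_1,\dots,x_n$ is a linear equation over $GF(2)$ of the form $x_{i_1}\oplus\cdots\oplus x_{i_k}=\varepsilon$ with $i_1<\dots<i_k$ distinct and $\varepsilon\in\{0,1\}$; there are $N_k=2\binom{n}{k}$ such clauses. A truth assignment $I:\{x_1,\dots,x_n\}\to\{0,1\}$ satisfies such a clause iff $\sum_j I(x_{i_j})\equiv\varepsilon \pmod 2$, and satisfies a formula (conjunction of clauses) iff it satisfies every clause. $\Omega(n,L,k)$ is the probability space of all ordered $L$-tuples of $k$-XOR-clauses over $n$ variables (chosen uniformly, independently, with replacement), each tuple having probability $(2\binom nk)^{ -L}$. -}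

module Defs where

open import Data.Bool using (Bool; true; false; _xor_; _∧_; if_then_else_; not)
import Data.Bool as B
open import Data.Nat using (ℕ; zero; suc; _⊔_; _^_; _∸_)
import Data.Nat as N
open import Data.Integer using (+_)
open import Data.Rational using (ℚ; _/_; 0ℚ; _+_; _*_)
open import Data.Vec using (Vec; []; _∷_; zipWith; replicate; foldr)
open import Data.Vec.Relation.Unary.All as VAll using () renaming (All to VecAll)
open import Data.List using (List; []; _∷_; _++_; map; filter; length; cartesianProduct)
import Data.List as L
open import Data.List.Membership.Propositional using (_∈_; lose; find)
open import Data.List.Membership.Propositional.Properties using (∈-++⁺ˡ; ∈-++⁺ʳ; ∈-map⁺)
open import Data.List.Relation.Unary.Any using (here; there; any?)
open import Data.Product using (Σ; ∃; ∃-syntax; _×_; _,_; proj₁; proj₂)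
open import Relation.Nullary using (Dec; yes; no; ¬_)
open import Relation.Binary.PropositionalEquality using (_≡_; refl)

allVecs : (n : ℕ) → List (Vec Bool n)
allVecs zero = [] ∷ []
allVecs (suc n) = map (false ∷_) (allVecs n) ++ map (true ∷_) (allVecs n)

allVecs-complete : ∀ {n} (v : Vec Bool n) → v ∈ allVecs n
allVecs-complete [] = here refl
allVecs-complete {suc n} (false ∷ v) = ∈-++⁺ˡ (∈-map⁺ (false ∷_) (allVecs-complete v))
allVecs-complete {suc n} (true ∷ v) =
  ∈-++⁺ʳ (map (false ∷_) (allVecs n)) (∈-map⁺ (true ∷_) (allVecs-complete v))

weight : ∀ {n} → Vec Bool n → ℕ
weight [] = 0
weight (false ∷ v) = weight v
weight (true ∷ v) = suc (weight v)

dot : ∀ {n} → Vec Bool n → Vec Bool n → Bool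
dot u v = foldr _ _xor_ false (zipWith _∧_ u v)

-- all vectors of weight exactly k, i.e. all index sets {i_1 < ... < i_k}
-- (as characteristic vectors); equivalently all admissible rows of M_{L,n,k}
weightVecs : (n k : ℕ) → List (Vec Bool n)
weightVecs n k = filter (λ v → weight v N.≟ k) (allVecs n)

tuples : ∀ {a} {A : Set a} → List A → (L : ℕ) → List (Vec A L)
tuples xs zero = [] ∷ []
tuples xs (suc L) = L.concatMap (λ x → map (x ∷_) (tuples xs L)) xs

-- a k-XOR-clause x_{i_1} ⊕ ... ⊕ x_{i_k} = ε : (characteristic vector of
-- {i_1,...,i_k}, ε)
Clause : ℕ → Set
Clause n = Vec Bool n × Bool

clauses : (n k : ℕ) → List (Clause n)
clauses n k = cartesianProduct (weightVecs n k) (false ∷ true ∷ [])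

SatClause : ∀ {n} → Vec Bool n → Clause n → Set
SatClause I (v , ε) = dot v I ≡ ε

SatFormula : ∀ {n L} → Vec Bool n → Vec (Clause n) L → Set
SatFormula I F = VecAll (SatClause I) F

Satisfiable : ∀ {n L} → Vec (Clause n) L → Set
Satisfiable {n} F = ∃[ I ] SatFormula {n} I F

satFormula? : ∀ {n L} (I : Vec Bool n) (F : Vec (Clause n) L) → Dec (SatFormula I F)
satFormula? I F = VAll.all? (λ c → dot (proj₁ c) I B.≟ proj₂ c) F

satisfiable? : ∀ {n L} (F : Vec (Clause n) L) → Dec (Satisfiable F)
satisfiable? {n} F with any? (λ I → satFormula? I F) (allVecs n)
... | yes p = yes (let (I , _ , s) = find p in I , s)
... | no ¬p = no λ { (I , s) → ¬p (lose (allVecs-complete I) s) }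

Ω : (n L k : ℕ) → List (Vec (Clause n) L)
Ω n L k = tuples (clauses n k) L

-- a / d as a rational (convention: 0 when d = 0; all denominators used
-- below are nonzero)
frac : ℕ → ℕ → ℚ
frac a zero = 0ℚ
frac a (suc d) = (+ a) / suc d

sumℚ : List ℚ → ℚ
sumℚ = L.foldr _+_ 0ℚ

prob : ∀ {a p} {A : Set a} {P : A → Set p} → (∀ x → Dec (P x)) → List A → ℚ
prob P? xs = frac (length (filter P? xs)) (length xs)

expect : ∀ {a} {A : Set a} → (A → ℚ) → List A → ℚ
expect f xs = sumℚ (map f xs) * frac 1 (length xs)

PSat : (n L k : ℕ) → ℚ
PSat n L k = prob satisfiable? (Ω n L k)

Matrix : ℕ → ℕ → Set
Matrix L n = Vec (Vec Bool n) L

Mat : (L n k : ℕ) → List (Matrix L n)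
Mat L n k = tuples (weightVecs n k) L

transposeMul : ∀ {L n} → Matrix L n → Vec Bool L → Vec Bool n
transposeMul {n = n} [] [] = replicate n false
transposeMul (r ∷ A) (b ∷ y) =
  if b then zipWith _xor_ r (transposeMul A y) else transposeMul A y

isZero : ∀ {n} → Vec Bool n → Bool
isZero [] = true
isZero (b ∷ v) = not b ∧ isZero v

Y : ∀ {L n} → Matrix L n → ℕ
Y {L} A = length (filter (λ y → isZero (transposeMul A y) B.≟ true) (allVecs L))

subsetB : ∀ {L} → Vec Bool L → Vec Bool L → Bool
subsetB [] [] = true
subsetB (t ∷ T) (s ∷ S) = (not t B.∨ s) ∧ subsetB T S

allB : ∀ {a} {A : Set a} → (A → Bool) → List A → Bool
allB p = L.foldr (λ x b → p x ∧ b) true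

-- the rows of A selected by S are linearly independent over GF(2):
-- no nonempty subfamily sums to zero
independentB : ∀ {L n} → Matrix L n → Vec Bool L → Bool
independentB {L} A S =
  allB (λ T → not (subsetB T S) B.∨ isZero T B.∨ not (isZero (transposeMul A T)))
        (allVecs L)

rank : ∀ {L n} → Matrix L n → ℕ
rank {L} A =
  L.foldr _⊔_ 0 (map weight (filter (λ S → independentB A S B.≟ true) (allVecs L)))

Prank : (L n k r : ℕ) → ℚ
Prank L n k r = prob (λ A → rank A N.≟ r) (Mat L n k)

rankSum : (n L k : ℕ) → ℚ
rankSum n L k = sumℚ (map (λ r → frac 1 (2 ^ (L ∸ r)) * Prank L n k r) (L.upTo (suc L)))

EinvY : (n L k : ℕ) → ℚ
EinvY n L k = expect (λ A → frac 1 (Y A)) (Mat L n k)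

-- A formula with clause rows A and right-hand sides b is satisfiable iff b lies in the image of A
-- over GF(2), so P_{n,L} is the average over A ∈ M_{L,n,k} of |im A| / 2^L. Two counts finish it.
-- First, |im A| · |ker Aᵀ| = 2^L, by induction on the rows using the Fredholm alternative: a new
-- row either lies in the row space, which doubles ker Aᵀ, or is detected by a kernel vector of A,
-- which doubles im A. Second, |ker Aᵀ| · 2^rank A = 2^L: a set S of rows is independent exactly when
-- ker Aᵀ meets the coordinate subspace spanned by S trivially, and such an S of maximal size is a
-- complement of ker Aᵀ. Hence |im A| = 2^rank A = 2^L / Y(A), and all three sides equal the average
-- of 2^(rank A − L).

module Submission where

open import Defs
open import Algebra.Bundles using (CommutativeRing; CommutativeMonoid)
import Algebra.Properties.CommutativeSemigroup as CommSemigroupProperties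
open import Data.Bool using (Bool; true; false; _xor_; _∧_; _∨_; not; if_then_else_)
import Data.Bool as B
open import Data.Bool.Properties
  using (xor-assoc; xor-identityˡ; xor-identityʳ; xor-same; ∧-distribˡ-xor; ∧-distribʳ-xor;
         xor-∧-commutativeRing; ∨-zeroʳ; ⇔→≡)
open import Data.Integer using () renaming (+_ to +ℤ_; _+_ to _+ℤ_; _*_ to _*ℤ_)
import Data.Integer.Properties as ZP
open import Data.List using (List; []; _∷_; _++_; map; filter; foldr; length; concatMap; cartesianProduct; upTo)
open import Data.List.Membership.Propositional using (_∈_)
open import Data.List.Membership.Propositional.Properties using (∈-map⁺; ∈-filter⁺; ∈-upTo⁺; ∈-upTo⁻)
open import Data.List.Properties using (foldr-preservesᵇ; foldr-preservesᵒ; map-cong; map-cong-local)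
open import Data.List.Relation.Unary.All using (All) renaming (map to All-map; lookup to All-lookup)
import Data.List.Relation.Unary.All as All
open import Data.List.Relation.Unary.All.Properties using (all-filter) renaming (map⁺ to All-map⁺)
open import Data.List.Relation.Unary.AllPairs using () renaming (_∷_ to _∷ᵘ_)
import Data.List.Relation.Unary.Any as Any
open import Data.List.Relation.Unary.Any using (here; there)
open import Data.List.Relation.Unary.Unique.Propositional using (Unique)
open import Data.List.Relation.Unary.Unique.Propositional.Properties using (upTo⁺)
open import Data.Nat using (ℕ; zero; suc; _+_; _*_; _^_; _≤_; _<_; _∸_; _⊔_; z≤n; s≤s)
import Data.Nat as N
import Data.Nat.Properties as NP
open import Data.Nat.Tactic.RingSolver using (solve-∀)
open import Data.Product using (∃-syntax; _×_; _,_; proj₁; proj₂)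
open import Data.Rational using (ℚ; 0ℚ; toℚᵘ) renaming (_+_ to _+ℚ_; _*_ to _*ℚ_)
import Data.Rational.Properties as QP
open import Data.Rational.Unnormalised using (mkℚᵘ; *≡*) renaming (_≃_ to _≃ᵘ_)
import Data.Rational.Unnormalised.Properties as UP
open import Data.Sum using (_⊎_; inj₁; inj₂; [_,_])
open import Data.Vec using (Vec; []; _∷_; zipWith; replicate; zip)
open import Data.Vec.Properties using (∷-injective)
open import Data.Vec.Relation.Binary.Pointwise.Inductive
  using (Pointwise-≡⇒≡; zipWith-assoc; zipWith-identityˡ; zipWith-identityʳ)
open import Data.Vec.Relation.Unary.All using ([]; _∷_)
open import Function.Bundles using (mk⇔)
open import Relation.Binary.PropositionalEquality
  using (_≡_; _≢_; refl; sym; trans; cong; cong₂; subst; module ≡-Reasoning)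
open import Relation.Nullary using (Dec; contradiction; does; yes; no)
open import Relation.Nullary.Decidable using (dec-true; dec-false)
open import Relation.Unary using (Pred; Decidable)

open CommSemigroupProperties
  (CommutativeMonoid.commutativeSemigroup (CommutativeRing.+-commutativeMonoid xor-∧-commutativeRing))
  using () renaming (interchange to xor-interchange)
open CommSemigroupProperties NP.+-commutativeSemigroup using () renaming (interchange to +-interchange)

infixl 6 _⊕_
_⊕_ : ∀ {n} → Vec Bool n → Vec Bool n → Vec Bool n
_⊕_ = zipWith _xor_

zeros : ∀ {n} → Vec Bool n
zeros {n} = replicate n false

⊕-assoc : ∀ {n} (u v w : Vec Bool n) → (u ⊕ v) ⊕ w ≡ u ⊕ (v ⊕ w)
⊕-assoc u v w = Pointwise-≡⇒≡ (zipWith-assoc xor-assoc u v w)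

⊕-identityˡ : ∀ {n} (u : Vec Bool n) → zeros ⊕ u ≡ u
⊕-identityˡ u = Pointwise-≡⇒≡ (zipWith-identityˡ xor-identityˡ u)

⊕-identityʳ : ∀ {n} (u : Vec Bool n) → u ⊕ zeros ≡ u
⊕-identityʳ u = Pointwise-≡⇒≡ (zipWith-identityʳ xor-identityʳ u)

⊕-self : ∀ {n} (u : Vec Bool n) → u ⊕ u ≡ zeros
⊕-self [] = refl
⊕-self (a ∷ u) = cong₂ _∷_ (xor-same a) (⊕-self u)

⊕-cancelˡ : ∀ {n} (u v : Vec Bool n) → u ⊕ (u ⊕ v) ≡ v
⊕-cancelˡ u v = begin
  u ⊕ (u ⊕ v) ≡⟨ ⊕-assoc u u v ⟨
  u ⊕ u ⊕ v   ≡⟨ cong (_⊕ v) (⊕-self u) ⟩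
  zeros ⊕ v   ≡⟨ ⊕-identityˡ v ⟩
  v           ∎
  where open ≡-Reasoning

⊕-interchange : ∀ {n} (a b c d : Vec Bool n) → (a ⊕ b) ⊕ (c ⊕ d) ≡ (a ⊕ c) ⊕ (b ⊕ d)
⊕-interchange [] [] [] [] = refl
⊕-interchange (a ∷ as) (b ∷ bs) (c ∷ cs) (d ∷ ds) =
  cong₂ _∷_ (xor-interchange a b c d) (⊕-interchange as bs cs ds)

isZero⇒≡zeros : ∀ {n} (u : Vec Bool n) → isZero u ≡ true → u ≡ zeros
isZero⇒≡zeros [] _ = refl
isZero⇒≡zeros (false ∷ u) h = cong (false ∷_) (isZero⇒≡zeros u h)

isZero-zeros : ∀ n → isZero (zeros {n}) ≡ true
isZero-zeros zero = refl
isZero-zeros (suc n) = isZero-zeros n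

isZero-⊕⇒≡ : ∀ {n} (u v : Vec Bool n) → isZero (u ⊕ v) ≡ true → u ≡ v
isZero-⊕⇒≡ [] [] _ = refl
isZero-⊕⇒≡ (false ∷ u) (false ∷ v) h = cong (false ∷_) (isZero-⊕⇒≡ u v h)
isZero-⊕⇒≡ (true ∷ u) (true ∷ v) h = cong (true ∷_) (isZero-⊕⇒≡ u v h)

dot-zerosˡ : ∀ {n} (u : Vec Bool n) → dot zeros u ≡ false
dot-zerosˡ [] = refl
dot-zerosˡ (a ∷ u) = dot-zerosˡ u

dot-zerosʳ : ∀ {n} (u : Vec Bool n) → dot u zeros ≡ false
dot-zerosʳ [] = refl
dot-zerosʳ (false ∷ u) = dot-zerosʳ u
dot-zerosʳ (true ∷ u) = dot-zerosʳ u

dot-⊕ˡ : ∀ {n} (u v x : Vec Bool n) → dot (u ⊕ v) x ≡ dot u x xor dot v x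
dot-⊕ˡ [] [] [] = refl
dot-⊕ˡ (a ∷ u) (b ∷ v) (c ∷ x) =
  trans (cong₂ _xor_ (∧-distribʳ-xor c a b) (dot-⊕ˡ u v x))
        (xor-interchange (a ∧ c) (b ∧ c) (dot u x) (dot v x))

dot-⊕ʳ : ∀ {n} (u x y : Vec Bool n) → dot u (x ⊕ y) ≡ dot u x xor dot u y
dot-⊕ʳ [] [] [] = refl
dot-⊕ʳ (a ∷ u) (b ∷ x) (c ∷ y) =
  trans (cong₂ _xor_ (∧-distribˡ-xor a b c) (dot-⊕ʳ u x y))
        (xor-interchange (a ∧ b) (a ∧ c) (dot u x) (dot u y))

infixr 7 _·_
_·_ : ∀ {L n} → Matrix L n → Vec Bool n → Vec Bool L
[] · x = []
(r ∷ A) · x = dot r x ∷ A · x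

·-⊕ : ∀ {L n} (A : Matrix L n) (x y : Vec Bool n) → A · (x ⊕ y) ≡ A · x ⊕ A · y
·-⊕ [] x y = refl
·-⊕ (r ∷ A) x y = cong₂ _∷_ (dot-⊕ʳ r x y) (·-⊕ A x y)

scale : ∀ {n} → Bool → Vec Bool n → Vec Bool n
scale b r = if b then r else zeros

scale-xor : ∀ {n} b c (r : Vec Bool n) → scale (b xor c) r ≡ scale b r ⊕ scale c r
scale-xor false c r = sym (⊕-identityˡ (scale c r))
scale-xor true false r = sym (⊕-identityʳ r)
scale-xor true true r = sym (⊕-self r)

transposeMul-∷ : ∀ {L n} (r : Vec Bool n) (A : Matrix L n) b y →
                 transposeMul (r ∷ A) (b ∷ y) ≡ scale b r ⊕ transposeMul A y
transposeMul-∷ r A false y = sym (⊕-identityˡ (transposeMul A y))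
transposeMul-∷ r A true y = refl

transposeMul-⊕ : ∀ {L n} (A : Matrix L n) (y z : Vec Bool L) →
                 transposeMul A (y ⊕ z) ≡ transposeMul A y ⊕ transposeMul A z
transposeMul-⊕ [] [] [] = sym (⊕-self zeros)
transposeMul-⊕ (r ∷ A) (b ∷ y) (c ∷ z) = begin
  transposeMul (r ∷ A) ((b xor c) ∷ (y ⊕ z))
    ≡⟨ transposeMul-∷ r A (b xor c) (y ⊕ z) ⟩
  scale (b xor c) r ⊕ transposeMul A (y ⊕ z)
    ≡⟨ cong₂ _⊕_ (scale-xor b c r) (transposeMul-⊕ A y z) ⟩
  (scale b r ⊕ scale c r) ⊕ (transposeMul A y ⊕ transposeMul A z)
    ≡⟨ ⊕-interchange (scale b r) (scale c r) (transposeMul A y) (transposeMul A z) ⟩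
  (scale b r ⊕ transposeMul A y) ⊕ (scale c r ⊕ transposeMul A z)
    ≡⟨ cong₂ _⊕_ (transposeMul-∷ r A b y) (transposeMul-∷ r A c z) ⟨
  transposeMul (r ∷ A) (b ∷ y) ⊕ transposeMul (r ∷ A) (c ∷ z) ∎
  where open ≡-Reasoning

transposeMul-zeros : ∀ {L n} (A : Matrix L n) → transposeMul A zeros ≡ zeros
transposeMul-zeros [] = refl
transposeMul-zeros (r ∷ A) = transposeMul-zeros A

dot-transposeMul : ∀ {L n} (A : Matrix L n) (y : Vec Bool L) (x : Vec Bool n) →
                   dot (transposeMul A y) x ≡ dot y (A · x)
dot-transposeMul [] [] x = dot-zerosˡ x
dot-transposeMul (r ∷ A) (false ∷ y) x = dot-transposeMul A y x
dot-transposeMul (r ∷ A) (true ∷ y) x =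
  trans (dot-⊕ˡ r (transposeMul A y) x) (cong (dot r x xor_) (dot-transposeMul A y x))

toℕ : Bool → ℕ
toℕ false = 0
toℕ true = 1

slice : ∀ {L} → Bool → (Vec Bool (suc L) → Bool) → Vec Bool L → Bool
slice b p y = p (b ∷ y)

count : ∀ {L} → (Vec Bool L → Bool) → ℕ
count {zero} p = toℕ (p [])
count {suc L} p = count (slice false p) + count (slice true p)

count-cong : ∀ {L} {p q : Vec Bool L → Bool} → (∀ y → p y ≡ q y) → count p ≡ count q
count-cong {zero} h = cong toℕ (h [])
count-cong {suc L} h = cong₂ _+_ (count-cong (λ y → h (false ∷ y))) (count-cong (λ y → h (true ∷ y)))

count-+ : ∀ {L} (p q r : Vec Bool L → Bool) →
          (∀ y → toℕ (p y) ≡ toℕ (q y) + toℕ (r y)) → count p ≡ count q + count r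
count-+ {zero} p q r h = h []
count-+ {suc L} p q r h =
  trans (cong₂ _+_ (count-+ (slice false p) (slice false q) (slice false r) (λ y → h (false ∷ y)))
                   (count-+ (slice true p) (slice true q) (slice true r) (λ y → h (true ∷ y))))
        (+-interchange (count (slice false q)) (count (slice false r))
                       (count (slice true q)) (count (slice true r)))

count-false : ∀ {L} (p : Vec Bool L → Bool) → (∀ y → p y ≡ false) → count p ≡ 0
count-false {zero} p h = cong toℕ (h [])
count-false {suc L} p h =
  cong₂ _+_ (count-false _ (λ y → h (false ∷ y))) (count-false _ (λ y → h (true ∷ y)))

count≤2^ : ∀ {L} (p : Vec Bool L → Bool) → count p ≤ 2 ^ L
count≤2^ {zero} p with p []
... | false = z≤n
... | true = s≤s z≤n
count≤2^ {suc L} p = subst (count p ≤_) (cong (2 ^ L +_) (sym (NP.+-identityʳ (2 ^ L))))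
  (NP.+-mono-≤ (count≤2^ (slice false p)) (count≤2^ (slice true p)))

count-pos : ∀ {L} (p : Vec Bool L → Bool) (w : Vec Bool L) → p w ≡ true → 0 < count p
count-pos {zero} p [] h rewrite h = s≤s z≤n
count-pos {suc L} p (false ∷ w) h = NP.≤-trans (count-pos _ w h) (NP.m≤m+n _ _)
count-pos {suc L} p (true ∷ w) h = NP.≤-trans (count-pos _ w h) (NP.m≤n+m _ _)

count-translate : ∀ {L} (q : Vec Bool L → Bool) (w : Vec Bool L) → count (λ y → q (w ⊕ y)) ≡ count q
count-translate {zero} q [] = refl
count-translate {suc L} q (false ∷ w) =
  cong₂ _+_ (count-translate (slice false q) w) (count-translate (slice true q) w)
count-translate {suc L} q (true ∷ w) =
  trans (cong₂ _+_ (count-translate (slice true q) w) (count-translate (slice false q) w))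
        (NP.+-comm (count (slice true q)) (count (slice false q)))

count-split : ∀ {L} (p q : Vec Bool L → Bool) →
              count (λ y → p y ∧ not (q y)) + count (λ y → p y ∧ q y) ≡ count p
count-split p q = sym (count-+ p _ _ (λ y → split (p y) (q y)))
  where
  split : ∀ a b → toℕ a ≡ toℕ (a ∧ not b) + toℕ (a ∧ b)
  split false b = refl
  split true false = refl
  split true true = refl

count-∨-disjoint : ∀ {L} (p q : Vec Bool L → Bool) → (∀ y → p y ∧ q y ≡ false) →
                   count (λ y → p y ∨ q y) ≡ count p + count q
count-∨-disjoint p q h = count-+ _ p q (λ y → disjoint (p y) (q y) (h y))
  where
  disjoint : ∀ a b → a ∧ b ≡ false → toℕ (a ∨ b) ≡ toℕ a + toℕ b
  disjoint false b _ = refl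
  disjoint true false _ = refl

any-true : ∀ {L} (q : Vec Bool L → Bool) → (∃[ w ] q w ≡ true) ⊎ (∀ w → q w ≡ false)
any-true {zero} q with q [] in e
... | true = inj₁ ([] , e)
... | false = inj₂ λ { [] → e }
any-true {suc L} q with any-true (slice false q) | any-true (slice true q)
... | inj₁ (w , e) | _ = inj₁ (false ∷ w , e)
... | inj₂ _ | inj₁ (w , e) = inj₁ (true ∷ w , e)
... | inj₂ none₀ | inj₂ none₁ = inj₂ λ { (false ∷ w) → none₀ w ; (true ∷ w) → none₁ w }

record IsSubspace {L} (K : Vec Bool L → Bool) : Set where
  field
    zeros∈ : K zeros ≡ true
    ⊕-closed : ∀ {u v} → K u ≡ true → K v ≡ true → K (u ⊕ v) ≡ true

-- For K = ker Aᵀ this says that the rows of A selected by S are linearly independent.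
MeetsTrivially : ∀ {L} → (Vec Bool L → Bool) → Vec Bool L → Set
MeetsTrivially {L} K S = ∀ (T : Vec Bool L) → subsetB T S ≡ true → K T ≡ true → isZero T ≡ true

subsetB-zeros : ∀ {L} (S : Vec Bool L) → subsetB zeros S ≡ true
subsetB-zeros [] = refl
subsetB-zeros (s ∷ S) = subsetB-zeros S

projection : ∀ {L} → (Vec Bool (suc L) → Bool) → Vec Bool L → Bool
projection K y = K (false ∷ y) ∨ K (true ∷ y)

module _ {L} {K : Vec Bool (suc L) → Bool} (sub : IsSubspace K) where
  open IsSubspace sub

  slice-false-subspace : IsSubspace (slice false K)
  slice-false-subspace = record { zeros∈ = zeros∈ ; ⊕-closed = ⊕-closed }

  slice-true≡translate : ∀ {w} → K (true ∷ w) ≡ true → ∀ y → slice true K y ≡ slice false K (w ⊕ y)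
  slice-true≡translate {w} Kw y = ⇔→≡ (mk⇔ (⊕-closed Kw)
    (λ h → subst (λ v → K (true ∷ v) ≡ true) (⊕-cancelˡ w y) (⊕-closed Kw h)))

  count-slice-true : ∀ {w} → K (true ∷ w) ≡ true → count (slice true K) ≡ count (slice false K)
  count-slice-true {w} Kw =
    trans (count-cong (slice-true≡translate Kw)) (count-translate (slice false K) w)

  count-slice-true≤ : count (slice true K) ≤ count (slice false K)
  count-slice-true≤ with any-true (slice true K)
  ... | inj₁ (w , Kw) = NP.≤-reflexive (count-slice-true Kw)
  ... | inj₂ none = subst (_≤ count (slice false K)) (sym (count-false _ none)) z≤n

  projection-subspace : IsSubspace (projection K)
  projection-subspace = record
    { zeros∈ = cong (_∨ K (true ∷ zeros)) zeros∈
    ; ⊕-closed = λ hu hv → closed (elim hu) (elim hv)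
    }
    where
    intro : ∀ b {y} → K (b ∷ y) ≡ true → projection K y ≡ true
    intro false h = cong (_∨ K (true ∷ _)) h
    intro true {y} h with K (false ∷ y)
    ... | false = h
    ... | true = refl
    elim : ∀ {y} → projection K y ≡ true → ∃[ b ] K (b ∷ y) ≡ true
    elim {y} h with K (false ∷ y) in e
    ... | true = false , e
    ... | false = true , h
    closed : ∀ {u v} → ∃[ b ] K (b ∷ u) ≡ true → ∃[ c ] K (c ∷ v) ≡ true → projection K (u ⊕ v) ≡ true
    closed (b , hu) (c , hv) = intro (b xor c) (⊕-closed hu hv)

  module _ {S : Vec Bool L} (triv : MeetsTrivially K (true ∷ S)) where

    projection-meetsTrivially : MeetsTrivially (projection K) S
    projection-meetsTrivially T T⊆S h with K (false ∷ T) in e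
    ... | true = triv (false ∷ T) T⊆S e
    ... | false with triv (true ∷ T) T⊆S h
    ... | ()

    -- A y in both slices would put (true ∷ zeros) = (false ∷ y) ⊕ (true ∷ y) into K.
    count-projection : count (projection K) ≡ count K
    count-projection = count-∨-disjoint (slice false K) (slice true K) disjoint
      where
      disjoint : ∀ y → K (false ∷ y) ∧ K (true ∷ y) ≡ false
      disjoint y with K (false ∷ y) in e₀ | K (true ∷ y) in e₁
      ... | false | _ = refl
      ... | true | false = refl
      ... | true | true with triv (true ∷ zeros) (subsetB-zeros S)
                                  (subst (λ v → K (true ∷ v) ≡ true) (⊕-self y) (⊕-closed e₀ e₁))
      ... | ()

double-*ˡ : ∀ c x → (c + c) * x ≡ 2 * (c * x)
double-*ˡ = solve-∀

double-*ʳ : ∀ c x → c * (2 * x) ≡ 2 * (c * x)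
double-*ʳ = solve-∀

∃-complement : ∀ {L} (K : Vec Bool L → Bool) → IsSubspace K →
               ∃[ S ] MeetsTrivially K S × count K * 2 ^ weight S ≡ 2 ^ L
∃-complement {zero} K sub = [] , (λ { [] _ _ → refl }) , cong (λ b → toℕ b * 1) (IsSubspace.zeros∈ sub)
∃-complement {suc L} K sub
  with ∃-complement (slice false K) (slice-false-subspace sub) | any-true (slice true K)
... | S , triv , eq | inj₁ (w , Kw) = false ∷ S , triv′ , count-eq
  where
  triv′ : MeetsTrivially K (false ∷ S)
  triv′ (false ∷ T) = triv T
  triv′ (true ∷ T) ()
  c₀ : ℕ
  c₀ = count (slice false K)
  count-eq : (c₀ + count (slice true K)) * 2 ^ weight S ≡ 2 * 2 ^ L
  count-eq = begin
    (c₀ + count (slice true K)) * 2 ^ weight S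
      ≡⟨ cong (λ c → (c₀ + c) * 2 ^ weight S) (count-slice-true sub Kw) ⟩
    (c₀ + c₀) * 2 ^ weight S
      ≡⟨ double-*ˡ c₀ (2 ^ weight S) ⟩
    2 * (c₀ * 2 ^ weight S)
      ≡⟨ cong (2 *_) eq ⟩
    2 * 2 ^ L ∎
    where open ≡-Reasoning
... | S , triv , eq | inj₂ none = true ∷ S , triv′ , count-eq
  where
  triv′ : MeetsTrivially K (true ∷ S)
  triv′ (false ∷ T) = triv T
  triv′ (true ∷ T) _ h = contradiction (trans (sym h) (none T)) λ ()
  c₀ : ℕ
  c₀ = count (slice false K)
  count-eq : (c₀ + count (slice true K)) * (2 * 2 ^ weight S) ≡ 2 * 2 ^ L
  count-eq = begin
    (c₀ + count (slice true K)) * (2 * 2 ^ weight S)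
      ≡⟨ cong (λ c → (c₀ + c) * (2 * 2 ^ weight S)) (count-false _ none) ⟩
    (c₀ + 0) * (2 * 2 ^ weight S)
      ≡⟨ cong (_* (2 * 2 ^ weight S)) (NP.+-identityʳ c₀) ⟩
    c₀ * (2 * 2 ^ weight S)
      ≡⟨ double-*ʳ c₀ (2 ^ weight S) ⟩
    2 * (c₀ * 2 ^ weight S)
      ≡⟨ cong (2 *_) eq ⟩
    2 * 2 ^ L ∎
    where open ≡-Reasoning

meetsTrivially⇒count≤ : ∀ {L} (K : Vec Bool L → Bool) → IsSubspace K → ∀ S → MeetsTrivially K S →
                        count K * 2 ^ weight S ≤ 2 ^ L
meetsTrivially⇒count≤ {zero} K _ [] _ = subst (_≤ 1) (sym (NP.*-identityʳ (count K))) (count≤2^ K)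
meetsTrivially⇒count≤ {suc L} K sub (false ∷ S) triv = begin
  (c₀ + count (slice true K)) * 2 ^ weight S
    ≤⟨ NP.*-monoˡ-≤ (2 ^ weight S) (NP.+-monoʳ-≤ c₀ (count-slice-true≤ sub)) ⟩
  (c₀ + c₀) * 2 ^ weight S
    ≡⟨ double-*ˡ c₀ (2 ^ weight S) ⟩
  2 * (c₀ * 2 ^ weight S)
    ≤⟨ NP.*-monoʳ-≤ 2 ih ⟩
  2 * 2 ^ L ∎
  where
  open NP.≤-Reasoning
  c₀ : ℕ
  c₀ = count (slice false K)
  ih : c₀ * 2 ^ weight S ≤ 2 ^ L
  ih = meetsTrivially⇒count≤ (slice false K) (slice-false-subspace sub) S (λ T → triv (false ∷ T))
meetsTrivially⇒count≤ {suc L} K sub (true ∷ S) triv = begin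
  count K * (2 * 2 ^ weight S)                  ≡⟨ cong (_* (2 * 2 ^ weight S)) (count-projection sub triv) ⟨
  count (projection K) * (2 * 2 ^ weight S)     ≡⟨ double-*ʳ (count (projection K)) (2 ^ weight S) ⟩
  2 * (count (projection K) * 2 ^ weight S)     ≤⟨ NP.*-monoʳ-≤ 2 ih ⟩
  2 * 2 ^ L                                     ∎
  where
  open NP.≤-Reasoning
  ih : count (projection K) * 2 ^ weight S ≤ 2 ^ L
  ih = meetsTrivially⇒count≤ (projection K) (projection-subspace sub) S (projection-meetsTrivially sub triv)

zeros⊎dot-true : ∀ {n} (r : Vec Bool n) → (r ≡ zeros) ⊎ (∃[ x ] dot r x ≡ true)
zeros⊎dot-true [] = inj₁ refl
zeros⊎dot-true (true ∷ r) = inj₂ (true ∷ zeros , cong (true xor_) (dot-zerosʳ r))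
zeros⊎dot-true (false ∷ r) with zeros⊎dot-true r
... | inj₁ e = inj₁ (cong (false ∷_) e)
... | inj₂ (x , e) = inj₂ (false ∷ x , e)

xor-true⇒≡not : ∀ a b → a xor b ≡ true → b ≡ not a
xor-true⇒≡not false true _ = refl
xor-true⇒≡not true false _ = refl

-- If the kernel witness x has a · x = 1, apply the alternative to a ⊕ r: either r = a ⊕ Aᵀ w,
-- or a kernel vector x′ of A detects a ⊕ r, and one of x′, x ⊕ x′ also annihilates a.
fredholm : ∀ {L n} (A : Matrix L n) (r : Vec Bool n) →
           (∃[ w ] transposeMul A w ≡ r) ⊎ (∃[ x ] A · x ≡ zeros × dot r x ≡ true)
fredholm [] r with zeros⊎dot-true r
... | inj₁ e = inj₁ ([] , sym e)
... | inj₂ (x , e) = inj₂ (x , refl , e)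
fredholm (a ∷ A) r with fredholm A r
... | inj₁ (w , e) = inj₁ (false ∷ w , e)
... | inj₂ (x , Ax≡0 , rx) with dot a x in ax
... | false = inj₂ (x , cong₂ _∷_ ax Ax≡0 , rx)
... | true with fredholm A (a ⊕ r)
... | inj₁ (w , e) = inj₁ (true ∷ w , trans (cong (a ⊕_) e) (⊕-cancelˡ a r))
... | inj₂ (x′ , Ax′≡0 , [a⊕r]x′)
  with xor-true⇒≡not (dot a x′) (dot r x′) (trans (sym (dot-⊕ˡ a r x′)) [a⊕r]x′)
... | rx′ with dot a x′ in ax′
... | false = inj₂ (x′ , cong₂ _∷_ ax′ Ax′≡0 , rx′)
... | true = inj₂ (x ⊕ x′ , cong₂ _∷_ a[x⊕x′] A[x⊕x′] , r[x⊕x′])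
  where
  a[x⊕x′] : dot a (x ⊕ x′) ≡ false
  a[x⊕x′] = trans (dot-⊕ʳ a x x′) (cong₂ _xor_ ax ax′)
  A[x⊕x′] : A · (x ⊕ x′) ≡ zeros
  A[x⊕x′] = trans (·-⊕ A x x′) (trans (cong₂ _⊕_ Ax≡0 Ax′≡0) (⊕-self zeros))
  r[x⊕x′] : dot r (x ⊕ x′) ≡ true
  r[x⊕x′] = trans (dot-⊕ʳ r x x′) (cong₂ _xor_ rx rx′)

solvable : ∀ {L n} → Matrix L n → Vec Bool L → Bool
solvable A b = does (satisfiable? (zip A b))

satFormula⇒· : ∀ {L n} (A : Matrix L n) b I → SatFormula I (zip A b) → A · I ≡ b
satFormula⇒· [] [] I [] = refl
satFormula⇒· (r ∷ A) (c ∷ b) I (rI≡c ∷ sat) = cong₂ _∷_ rI≡c (satFormula⇒· A b I sat)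

·⇒satFormula : ∀ {L n} (A : Matrix L n) I → SatFormula I (zip A (A · I))
·⇒satFormula [] I = []
·⇒satFormula (r ∷ A) I = refl ∷ ·⇒satFormula A I

solvable⇒ : ∀ {L n} (A : Matrix L n) b → solvable A b ≡ true → ∃[ x ] A · x ≡ b
solvable⇒ A b h with satisfiable? (zip A b)
... | yes (I , sat) = I , satFormula⇒· A b I sat

⇒solvable : ∀ {L n} (A : Matrix L n) {b} x → A · x ≡ b → solvable A b ≡ true
⇒solvable A x refl = dec-true (satisfiable? (zip A (A · x))) (x , ·⇒satFormula A x)

solvable-∷⇒ : ∀ {L n} r (A : Matrix L n) c₀ c → solvable (r ∷ A) (c₀ ∷ c) ≡ true →
              ∃[ x ] A · x ≡ c × dot r x ≡ c₀
solvable-∷⇒ r A c₀ c h with solvable⇒ (r ∷ A) (c₀ ∷ c) h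
... | x , e = x , proj₂ (∷-injective e) , proj₁ (∷-injective e)

kernelᵀ : ∀ {L n} → Matrix L n → Vec Bool L → Bool
kernelᵀ A y = isZero (transposeMul A y)

kernelᵀ-subspace : ∀ {L n} (A : Matrix L n) → IsSubspace (kernelᵀ A)
kernelᵀ-subspace {n = n} A = record
  { zeros∈ = trans (cong isZero (transposeMul-zeros A)) (isZero-zeros n)
  ; ⊕-closed = λ {u} {v} hu hv → trans
      (cong isZero (trans (transposeMul-⊕ A u v)
        (trans (cong₂ _⊕_ (isZero⇒≡zeros _ hu) (isZero⇒≡zeros _ hv)) (⊕-self zeros))))
      (isZero-zeros n)
  }

literal : Bool → Bool → Bool
literal b x = if b then x else not x

literal-≡ : ∀ {b x} → literal b x ≡ true → x ≡ b
literal-≡ {false} {false} _ = refl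
literal-≡ {true} {true} _ = refl

≡-literal : ∀ {b x} → x ≡ b → literal b x ≡ true
≡-literal {false} refl = refl
≡-literal {true} refl = refl

≡-∧ : ∀ {a b c} → (a ≡ true → b ≡ true × c ≡ true) → (b ≡ true → c ≡ true → a ≡ true) → a ≡ b ∧ c
≡-∧ {b = true} {true} _ g = g refl refl
≡-∧ {false} {false} f _ = refl
≡-∧ {false} {true} {false} f _ = refl
≡-∧ {true} {false} f _ with f refl
... | () , _
≡-∧ {true} {true} {false} f _ with f refl
... | _ , ()

module _ {L n} (r : Vec Bool n) (A : Matrix L n) where

  module _ {w : Vec Bool L} (Aᵀw≡r : transposeMul A w ≡ r) where

    dot-row-dependent : ∀ x → dot r x ≡ dot w (A · x)
    dot-row-dependent x = trans (cong (λ v → dot v x) (sym Aᵀw≡r)) (dot-transposeMul A w x)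

    solvable-∷-dependent : ∀ c₀ c → solvable (r ∷ A) (c₀ ∷ c) ≡ solvable A c ∧ literal c₀ (dot w c)
    solvable-∷-dependent c₀ c = ≡-∧ to from
      where
      to : solvable (r ∷ A) (c₀ ∷ c) ≡ true → solvable A c ≡ true × literal c₀ (dot w c) ≡ true
      to h with solvable-∷⇒ r A c₀ c h
      ... | x , refl , refl = ⇒solvable A x refl , ≡-literal (sym (dot-row-dependent x))
      from : solvable A c ≡ true → literal c₀ (dot w c) ≡ true → solvable (r ∷ A) (c₀ ∷ c) ≡ true
      from h l with solvable⇒ A c h
      ... | x , refl = ⇒solvable (r ∷ A) x (cong (_∷ A · x) (trans (dot-row-dependent x) (literal-≡ l)))

    count-solvable-dependent : count (solvable (r ∷ A)) ≡ count (solvable A)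
    count-solvable-dependent =
      trans (cong₂ _+_ (count-cong (solvable-∷-dependent false)) (count-cong (solvable-∷-dependent true)))
            (count-split (solvable A) (dot w))

    count-kernelᵀ-dependent : count (kernelᵀ (r ∷ A)) ≡ count (kernelᵀ A) + count (kernelᵀ A)
    count-kernelᵀ-dependent = cong (count (kernelᵀ A) +_)
      (trans (count-cong (λ y → cong isZero (begin
                r ⊕ transposeMul A y                ≡⟨ cong (_⊕ transposeMul A y) Aᵀw≡r ⟨
                transposeMul A w ⊕ transposeMul A y ≡⟨ transposeMul-⊕ A w y ⟨
                transposeMul A (w ⊕ y)              ∎)))
             (count-translate (kernelᵀ A) w))
      where open ≡-Reasoning

  module _ {x₀ : Vec Bool n} (Ax₀≡0 : A · x₀ ≡ zeros) (rx₀ : dot r x₀ ≡ true) where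

    solvable-∷-independent : ∀ c₀ c → solvable (r ∷ A) (c₀ ∷ c) ≡ solvable A c
    solvable-∷-independent c₀ c = ⇔→≡ (mk⇔ to from)
      where
      to : solvable (r ∷ A) (c₀ ∷ c) ≡ true → solvable A c ≡ true
      to h with solvable-∷⇒ r A c₀ c h
      ... | x , Ax≡c , _ = ⇒solvable A x Ax≡c
      -- if x misses the new equation, x ⊕ x₀ satisfies it
      from : solvable A c ≡ true → solvable (r ∷ A) (c₀ ∷ c) ≡ true
      from h with solvable⇒ A c h
      ... | x , Ax≡c with dot r x B.≟ c₀
      ... | yes rx≡c₀ = ⇒solvable (r ∷ A) x (cong₂ _∷_ rx≡c₀ Ax≡c)
      ... | no rx≢c₀ = ⇒solvable (r ∷ A) (x ⊕ x₀) (cong₂ _∷_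
            (trans (dot-⊕ʳ r x x₀) (trans (cong (dot r x xor_) rx₀) (flip rx≢c₀)))
            (trans (·-⊕ A x x₀) (trans (cong₂ _⊕_ Ax≡c Ax₀≡0) (⊕-identityʳ c))))
        where
        flip : ∀ {a b} → a ≢ b → a xor true ≡ b
        flip {false} {false} ne = contradiction refl ne
        flip {false} {true} _ = refl
        flip {true} {false} _ = refl
        flip {true} {true} ne = contradiction refl ne

    kernelᵀ-∷-independent : ∀ y → kernelᵀ (r ∷ A) (true ∷ y) ≡ false
    kernelᵀ-∷-independent y with kernelᵀ (r ∷ A) (true ∷ y) in e
    ... | false = refl
    ... | true = contradiction (begin
          true                            ≡⟨ rx₀ ⟨
          dot r x₀                        ≡⟨ cong (λ v → dot v x₀) (isZero-⊕⇒≡ r (transposeMul A y) e) ⟩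
          dot (transposeMul A y) x₀       ≡⟨ dot-transposeMul A y x₀ ⟩
          dot y (A · x₀)                  ≡⟨ cong (dot y) Ax₀≡0 ⟩
          dot y zeros                     ≡⟨ dot-zerosʳ y ⟩
          false                           ∎) λ ()
      where open ≡-Reasoning

count-solvable*count-kernelᵀ : ∀ {L n} (A : Matrix L n) → count (solvable A) * count (kernelᵀ A) ≡ 2 ^ L
count-solvable*count-kernelᵀ {zero} {n} [] =
  cong₂ (λ a b → toℕ a * toℕ b) (⇒solvable [] (zeros {n}) refl) (isZero-zeros n)
count-solvable*count-kernelᵀ {suc L} (r ∷ A) with fredholm A r
... | inj₁ (w , Aᵀw≡r) = begin
  count (solvable (r ∷ A)) * count (kernelᵀ (r ∷ A))
    ≡⟨ cong₂ _*_ (count-solvable-dependent r A Aᵀw≡r) (count-kernelᵀ-dependent r A Aᵀw≡r) ⟩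
  count (solvable A) * (count (kernelᵀ A) + count (kernelᵀ A))
    ≡⟨ NP.*-comm (count (solvable A)) _ ⟩
  (count (kernelᵀ A) + count (kernelᵀ A)) * count (solvable A)
    ≡⟨ double-*ˡ (count (kernelᵀ A)) (count (solvable A)) ⟩
  2 * (count (kernelᵀ A) * count (solvable A))
    ≡⟨ cong (2 *_) (trans (NP.*-comm (count (kernelᵀ A)) _) (count-solvable*count-kernelᵀ A)) ⟩
  2 * 2 ^ L ∎
  where open ≡-Reasoning
... | inj₂ (x₀ , Ax₀≡0 , rx₀) = begin
  count (solvable (r ∷ A)) * count (kernelᵀ (r ∷ A))
    ≡⟨ cong₂ _*_ (cong₂ _+_ (count-cong (solvable-∷-independent r A Ax₀≡0 rx₀ false))
                            (count-cong (solvable-∷-independent r A Ax₀≡0 rx₀ true)))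
                 (cong (count (kernelᵀ A) +_) (count-false _ (kernelᵀ-∷-independent r A Ax₀≡0 rx₀))) ⟩
  (count (solvable A) + count (solvable A)) * (count (kernelᵀ A) + 0)
    ≡⟨ cong ((count (solvable A) + count (solvable A)) *_) (NP.+-identityʳ (count (kernelᵀ A))) ⟩
  (count (solvable A) + count (solvable A)) * count (kernelᵀ A)
    ≡⟨ double-*ˡ (count (solvable A)) (count (kernelᵀ A)) ⟩
  2 * (count (solvable A) * count (kernelᵀ A))
    ≡⟨ cong (2 *_) (count-solvable*count-kernelᵀ A) ⟩
  2 * 2 ^ L ∎
  where open ≡-Reasoning

foldr-⊔-≤ : ∀ {m} (ns : List ℕ) → All (_≤ m) ns → foldr _⊔_ 0 ns ≤ m
foldr-⊔-≤ ns = foldr-preservesᵇ NP.⊔-lub z≤n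

≤-foldr-⊔ : ∀ {m} (ns : List ℕ) → m ∈ ns → m ≤ foldr _⊔_ 0 ns
≤-foldr-⊔ ns m∈ns = foldr-preservesᵒ
  (λ x y → [ NP.m≤n⇒m≤n⊔o y , NP.m≤n⇒m≤o⊔n x ]) 0 ns (inj₂ (Any.map NP.≤-reflexive m∈ns))

2^-cancel-≤ : ∀ {w w₀} → 2 ^ w ≤ 2 ^ w₀ → w ≤ w₀
2^-cancel-≤ le = NP.≮⇒≥ (λ w₀<w → NP.<⇒≱ (NP.^-monoʳ-< 2 (s≤s (s≤s z≤n)) w₀<w) le)

weight≤ : ∀ {L} (S : Vec Bool L) → weight S ≤ L
weight≤ [] = z≤n
weight≤ (false ∷ S) = NP.m≤n⇒m≤1+n (weight≤ S)
weight≤ (true ∷ S) = s≤s (weight≤ S)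

allB-true⇒ : ∀ {a} {A : Set a} (q : A → Bool) {xs x} → allB q xs ≡ true → x ∈ xs → q x ≡ true
allB-true⇒ q {y ∷ _} h (here refl) with q y
... | true = refl
allB-true⇒ q {y ∷ _} h (there x∈xs) with q y
... | true = allB-true⇒ q h x∈xs

⇒allB-true : ∀ {a} {A : Set a} (q : A → Bool) xs → (∀ x → q x ≡ true) → allB q xs ≡ true
⇒allB-true q [] _ = refl
⇒allB-true q (x ∷ xs) h rewrite h x = ⇒allB-true q xs h

implies⇒ : ∀ {a b c} → not a ∨ c ∨ not b ≡ true → a ≡ true → b ≡ true → c ≡ true
implies⇒ {c = true} _ _ _ = refl
implies⇒ {true} {true} {false} () refl refl

⇒implies : ∀ a b c → (a ≡ true → b ≡ true → c ≡ true) → not a ∨ c ∨ not b ≡ true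
⇒implies false b c _ = refl
⇒implies true false c _ = ∨-zeroʳ c
⇒implies true true c f rewrite f refl refl = refl

independentB⇒ : ∀ {L n} (A : Matrix L n) S → independentB A S ≡ true → MeetsTrivially (kernelᵀ A) S
independentB⇒ A S h T = implies⇒ (allB-true⇒ _ h (allVecs-complete T))

⇒independentB : ∀ {L n} (A : Matrix L n) S → MeetsTrivially (kernelᵀ A) S → independentB A S ≡ true
⇒independentB {L} A S triv =
  ⇒allB-true _ (allVecs L) (λ T → ⇒implies (subsetB T S) (kernelᵀ A T) (isZero T) (triv T))

rank≤ : ∀ {L n} (A : Matrix L n) → rank A ≤ L
rank≤ {L} A = foldr-⊔-≤ _ (All-map⁺ (All-map (λ {S} _ → weight≤ S) (all-filter _ (allVecs L))))

count-kernelᵀ-pos : ∀ {L n} (A : Matrix L n) → 0 < count (kernelᵀ A)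
count-kernelᵀ-pos A = count-pos (kernelᵀ A) zeros (IsSubspace.zeros∈ (kernelᵀ-subspace A))

count-kernelᵀ*2^rank : ∀ {L n} (A : Matrix L n) → count (kernelᵀ A) * 2 ^ rank A ≡ 2 ^ L
count-kernelᵀ*2^rank {L} A with ∃-complement (kernelᵀ A) (kernelᵀ-subspace A)
... | S₀ , triv₀ , eq₀ = subst (λ w → count (kernelᵀ A) * 2 ^ w ≡ 2 ^ L) (sym rank≡weight) eq₀
  where
  independent? : (S : Vec Bool L) → Dec (independentB A S ≡ true)
  independent? S = independentB A S B.≟ true
  maximal : ∀ {S} → independentB A S ≡ true → weight S ≤ weight S₀
  maximal {S} h = 2^-cancel-≤ (NP.*-cancelˡ-≤ (count (kernelᵀ A)) {{N.>-nonZero (count-kernelᵀ-pos A)}}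
    (NP.≤-trans (meetsTrivially⇒count≤ (kernelᵀ A) (kernelᵀ-subspace A) S (independentB⇒ A S h))
                (NP.≤-reflexive (sym eq₀))))
  rank≡weight : rank A ≡ weight S₀
  rank≡weight = NP.≤-antisym
    (foldr-⊔-≤ _ (All-map⁺ (All-map maximal (all-filter independent? (allVecs L)))))
    (≤-foldr-⊔ _ (∈-map⁺ weight
      (∈-filter⁺ independent? (allVecs-complete S₀) (⇒independentB A S₀ triv₀))))

count-solvable≡2^rank : ∀ {L n} (A : Matrix L n) → count (solvable A) ≡ 2 ^ rank A
count-solvable≡2^rank {L} A = NP.*-cancelʳ-≡ (count (solvable A)) (2 ^ rank A) (count (kernelᵀ A))
  {{N.>-nonZero (count-kernelᵀ-pos A)}}
  (trans (count-solvable*count-kernelᵀ A)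
         (trans (sym (count-kernelᵀ*2^rank A)) (NP.*-comm (count (kernelᵀ A)) (2 ^ rank A))))

∑ : ∀ {a} {A : Set a} → List A → (A → ℕ) → ℕ
∑ [] f = 0
∑ (x ∷ xs) f = f x + ∑ xs f

infix 5 ∑
syntax ∑ xs (λ x → e) = ∑[ x ∈ xs ] e

∑-cong : ∀ {a} {A : Set a} (xs : List A) {f g : A → ℕ} → (∀ x → f x ≡ g x) → ∑ xs f ≡ ∑ xs g
∑-cong [] _ = refl
∑-cong (x ∷ xs) h = cong₂ _+_ (h x) (∑-cong xs h)

∑-++ : ∀ {a} {A : Set a} (xs ys : List A) (f : A → ℕ) → ∑ (xs ++ ys) f ≡ ∑ xs f + ∑ ys f
∑-++ [] ys f = refl
∑-++ (x ∷ xs) ys f = trans (cong (f x +_) (∑-++ xs ys f)) (sym (NP.+-assoc (f x) _ _))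

∑-map : ∀ {a b} {A : Set a} {B : Set b} (g : A → B) (xs : List A) (f : B → ℕ) →
        ∑ (map g xs) f ≡ ∑[ x ∈ xs ] f (g x)
∑-map g [] f = refl
∑-map g (x ∷ xs) f = cong (f (g x) +_) (∑-map g xs f)

∑-concatMap : ∀ {a b} {A : Set a} {B : Set b} (g : A → List B) (xs : List A) (f : B → ℕ) →
              ∑ (concatMap g xs) f ≡ ∑[ x ∈ xs ] ∑ (g x) f
∑-concatMap g [] f = refl
∑-concatMap g (x ∷ xs) f = trans (∑-++ (g x) (concatMap g xs) f) (cong (∑ (g x) f +_) (∑-concatMap g xs f))

∑-+ : ∀ {a} {A : Set a} (xs : List A) (f g : A → ℕ) → ∑[ x ∈ xs ] (f x + g x) ≡ ∑ xs f + ∑ xs g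
∑-+ [] f g = refl
∑-+ (x ∷ xs) f g =
  trans (cong (f x + g x +_) (∑-+ xs f g)) (+-interchange (f x) (g x) (∑ xs f) (∑ xs g))

∑-*ˡ : ∀ {a} {A : Set a} c (xs : List A) (f : A → ℕ) → c * ∑ xs f ≡ ∑[ x ∈ xs ] c * f x
∑-*ˡ c [] f = NP.*-zeroʳ c
∑-*ˡ c (x ∷ xs) f = trans (NP.*-distribˡ-+ c (f x) (∑ xs f)) (cong (c * f x +_) (∑-*ˡ c xs f))

∑-1 : ∀ {a} {A : Set a} (xs : List A) → ∑[ x ∈ xs ] 1 ≡ length xs
∑-1 [] = refl
∑-1 (x ∷ xs) = cong suc (∑-1 xs)

∑-const : ∀ {a} {A : Set a} c (xs : List A) → ∑[ x ∈ xs ] c ≡ c * length xs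
∑-const c xs = begin
  ∑[ x ∈ xs ] c       ≡⟨ ∑-cong xs (λ _ → sym (NP.*-identityʳ c)) ⟩
  ∑[ x ∈ xs ] c * 1   ≡⟨ ∑-*ˡ c xs (λ _ → 1) ⟨
  c * (∑[ x ∈ xs ] 1) ≡⟨ cong (c *_) (∑-1 xs) ⟩
  c * length xs       ∎
  where open ≡-Reasoning

∑-comm : ∀ {a b} {A : Set a} {B : Set b} (xs : List A) (ys : List B) (f : A → B → ℕ) →
         ∑[ x ∈ xs ] ∑[ y ∈ ys ] f x y ≡ ∑[ y ∈ ys ] ∑[ x ∈ xs ] f x y
∑-comm [] ys f = sym (trans (∑-const 0 ys) (NP.*-zeroˡ (length ys)))
∑-comm (x ∷ xs) ys f =
  trans (cong (∑ ys (f x) +_) (∑-comm xs ys f)) (sym (∑-+ ys (f x) (λ y → ∑[ x ∈ xs ] f x y)))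

length-filter : ∀ {a p} {A : Set a} {P : Pred A p} (P? : Decidable P) xs →
                length (filter P? xs) ≡ ∑[ x ∈ xs ] toℕ (does (P? x))
length-filter P? [] = refl
length-filter P? (x ∷ xs) with P? x
... | yes _ = cong suc (length-filter P? xs)
... | no _ = length-filter P? xs

module _ (g : ℕ → ℕ) {j : ℕ} where

  ∑-indicator-∉ : ∀ {xs} → All (j ≢_) xs → ∑[ r ∈ xs ] g r * toℕ (does (j N.≟ r)) ≡ 0
  ∑-indicator-∉ All.[] = refl
  ∑-indicator-∉ {r ∷ _} (j≢r All.∷ j∉xs) rewrite dec-false (j N.≟ r) j≢r | NP.*-zeroʳ (g r) =
    ∑-indicator-∉ j∉xs

  ∑-indicator : ∀ {xs} → Unique xs → j ∈ xs → ∑[ r ∈ xs ] g r * toℕ (does (j N.≟ r)) ≡ g j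
  ∑-indicator (j∉xs ∷ᵘ _) (here refl) rewrite dec-true (j N.≟ j) refl | ∑-indicator-∉ j∉xs =
    trans (NP.+-identityʳ (g j * 1)) (NP.*-identityʳ (g j))
  ∑-indicator {r ∷ _} (r∉xs ∷ᵘ unique) (there j∈xs)
    rewrite dec-false (j N.≟ r) (λ j≡r → All-lookup r∉xs j∈xs (sym j≡r)) | NP.*-zeroʳ (g r) =
    ∑-indicator unique j∈xs

∑-allVecs : ∀ {L} (p : Vec Bool L → Bool) → ∑[ y ∈ allVecs L ] toℕ (p y) ≡ count p
∑-allVecs {zero} p = NP.+-identityʳ (toℕ (p []))
∑-allVecs {suc L} p = begin
  ∑ (map (false ∷_) (allVecs L) ++ map (true ∷_) (allVecs L)) (λ y → toℕ (p y))
    ≡⟨ ∑-++ (map (false ∷_) (allVecs L)) _ _ ⟩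
  ∑ (map (false ∷_) (allVecs L)) (λ y → toℕ (p y)) + ∑ (map (true ∷_) (allVecs L)) (λ y → toℕ (p y))
    ≡⟨ cong₂ _+_ (∑-map (false ∷_) (allVecs L) _) (∑-map (true ∷_) (allVecs L) _) ⟩
  (∑[ y ∈ allVecs L ] toℕ (p (false ∷ y))) + (∑[ y ∈ allVecs L ] toℕ (p (true ∷ y)))
    ≡⟨ cong₂ _+_ (∑-allVecs (slice false p)) (∑-allVecs (slice true p)) ⟩
  count p ∎
  where open ≡-Reasoning

Y≡count-kernelᵀ : ∀ {L n} (A : Matrix L n) → Y A ≡ count (kernelᵀ A)
Y≡count-kernelᵀ {L} A = trans (length-filter _ (allVecs L))
  (trans (∑-cong (allVecs L) (λ y → toℕ-does-≟true (kernelᵀ A y))) (∑-allVecs (kernelᵀ A)))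
  where
  toℕ-does-≟true : ∀ b → toℕ (does (b B.≟ true)) ≡ toℕ b
  toℕ-does-≟true false = refl
  toℕ-does-≟true true = refl

-- An L-tuple of clauses over the rows R is a matrix A ∈ tuples R L zipped with a right-hand side b.
∑-tuples-clauses : ∀ {n} (R : List (Vec Bool n)) L (q : Vec (Clause n) L → Bool) →
  ∑[ F ∈ tuples (cartesianProduct R (false ∷ true ∷ [])) L ] toℕ (q F) ≡
  ∑[ A ∈ tuples R L ] count (λ b → q (zip A b))
∑-tuples-clauses R zero q = refl
∑-tuples-clauses {n} R (suc L) q = begin
  ∑ (concatMap (λ c → map (c ∷_) (tuples C L)) C) (λ F → toℕ (q F))
    ≡⟨ ∑-concatMap (λ c → map (c ∷_) (tuples C L)) C _ ⟩
  ∑[ c ∈ C ] ∑ (map (c ∷_) (tuples C L)) (λ F → toℕ (q F))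
    ≡⟨ ∑-cong C (λ c → trans (∑-map (c ∷_) (tuples C L) _) (∑-tuples-clauses R L (λ F → q (c ∷ F)))) ⟩
  ∑[ c ∈ C ] g c
    ≡⟨ ∑-cartesian-Bool R ⟩
  ∑[ r ∈ R ] (g (r , false) + g (r , true))
    ≡⟨ ∑-cong R (λ r → sym (∑-+ (tuples R L) _ _)) ⟩
  ∑[ r ∈ R ] ∑[ A ∈ tuples R L ] count (λ b → q (zip (r ∷ A) b))
    ≡⟨ ∑-cong R (λ r → ∑-map (r ∷_) (tuples R L) (λ A → count (λ b → q (zip A b)))) ⟨
  ∑[ r ∈ R ] ∑ (map (r ∷_) (tuples R L)) (λ A → count (λ b → q (zip A b)))
    ≡⟨ ∑-concatMap (λ r → map (r ∷_) (tuples R L)) R _ ⟨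
  ∑ (concatMap (λ r → map (r ∷_) (tuples R L)) R) (λ A → count (λ b → q (zip A b))) ∎
  where
  open ≡-Reasoning
  C : List (Clause n)
  C = cartesianProduct R (false ∷ true ∷ [])
  g : Clause n → ℕ
  g c = ∑[ A ∈ tuples R L ] count (λ b → q (c ∷ zip A b))
  ∑-cartesian-Bool : ∀ R′ →
    ∑ (cartesianProduct R′ (false ∷ true ∷ [])) g ≡ ∑[ r ∈ R′ ] (g (r , false) + g (r , true))
  ∑-cartesian-Bool [] = refl
  ∑-cartesian-Bool (r ∷ R′) =
    trans (∑-++ ((r , false) ∷ (r , true) ∷ []) (cartesianProduct R′ (false ∷ true ∷ [])) g)
          (cong₂ _+_ (cong (g (r , false) +_) (NP.+-identityʳ (g (r , true)))) (∑-cartesian-Bool R′))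

count-satisfiable : ∀ n L k → length (filter satisfiable? (Ω n L k)) ≡ ∑[ A ∈ Mat L n k ] 2 ^ rank A
count-satisfiable n L k =
  trans (length-filter satisfiable? (Ω n L k))
  (trans (∑-tuples-clauses (weightVecs n k) L (λ F → does (satisfiable? F)))
         (∑-cong (Mat L n k) count-solvable≡2^rank))

count-true : ∀ L → count {L} (λ _ → true) ≡ 2 ^ L
count-true zero = refl
count-true (suc L) = cong₂ _+_ (count-true L) (trans (count-true L) (sym (NP.+-identityʳ (2 ^ L))))

length-Ω : ∀ n L k → length (Ω n L k) ≡ 2 ^ L * length (Mat L n k)
length-Ω n L k = begin
  length (Ω n L k)                           ≡⟨ ∑-1 (Ω n L k) ⟨
  ∑[ F ∈ Ω n L k ] 1                         ≡⟨ ∑-tuples-clauses (weightVecs n k) L (λ _ → true) ⟩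
  ∑[ A ∈ Mat L n k ] count {L} (λ _ → true)  ≡⟨ ∑-cong (Mat L n k) (λ _ → count-true L) ⟩
  ∑[ A ∈ Mat L n k ] 2 ^ L                   ≡⟨ ∑-const (2 ^ L) (Mat L n k) ⟩
  2 ^ L * length (Mat L n k)                 ∎
  where open ≡-Reasoning

frac-0 : ∀ d → frac 0 d ≡ 0ℚ
frac-0 zero = refl
frac-0 (suc d) = QP.0/n≡0 (suc d)

-- frac a (suc d) is fromℚᵘ (mkℚᵘ (+ a) d), so identities between fracs are checked in ℚᵘ.
frac-via-ℚᵘ : ∀ {p} a d → toℚᵘ p ≃ᵘ mkℚᵘ (+ℤ a) d → p ≡ frac a (suc d)
frac-via-ℚᵘ a d p≃ = QP.toℚᵘ-injective (UP.≃-trans p≃ (UP.≃-sym (QP.toℚᵘ-fromℚᵘ (mkℚᵘ (+ℤ a) d))))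

frac-scale : ∀ a d m → 0 < m → frac a d ≡ frac (m * a) (m * d)
frac-scale a zero m _ rewrite NP.*-zeroʳ m = refl
frac-scale a (suc d) (suc m) _ = frac-via-ℚᵘ (suc m * a) (d + m * suc d)
  (UP.≃-trans (QP.toℚᵘ-fromℚᵘ (mkℚᵘ (+ℤ a) d)) (*≡* (begin
    +ℤ a *ℤ +ℤ (suc m * suc d)     ≡⟨ ZP.pos-* a (suc m * suc d) ⟨
    +ℤ (a * (suc m * suc d))       ≡⟨ cong +ℤ_ (reassoc a (suc m) (suc d)) ⟩
    +ℤ (suc m * a * suc d)         ≡⟨ ZP.pos-* (suc m * a) (suc d) ⟩
    +ℤ (suc m * a) *ℤ +ℤ (suc d)   ∎)))
  where
  open ≡-Reasoning
  reassoc : ∀ a m d → a * (m * d) ≡ m * a * d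
  reassoc = solve-∀

frac-+ : ∀ a b d → frac a d +ℚ frac b d ≡ frac (a + b) d
frac-+ a b zero = QP.+-identityˡ 0ℚ
frac-+ a b (suc d) = frac-via-ℚᵘ (a + b) d
  (UP.≃-trans (QP.toℚᵘ-homo-+ (frac a (suc d)) (frac b (suc d)))
  (UP.≃-trans (UP.+-cong (QP.toℚᵘ-fromℚᵘ (mkℚᵘ (+ℤ a) d)) (QP.toℚᵘ-fromℚᵘ (mkℚᵘ (+ℤ b) d)))
  (*≡* (begin
    (+ℤ a *ℤ +ℤ D +ℤ +ℤ b *ℤ +ℤ D) *ℤ +ℤ D
      ≡⟨ cong (_*ℤ +ℤ D) (cong₂ _+ℤ_ (ZP.pos-* a D) (ZP.pos-* b D)) ⟨
    (+ℤ (a * D) +ℤ +ℤ (b * D)) *ℤ +ℤ D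
      ≡⟨ cong (_*ℤ +ℤ D) (ZP.pos-+ (a * D) (b * D)) ⟨
    +ℤ (a * D + b * D) *ℤ +ℤ D
      ≡⟨ ZP.pos-* (a * D + b * D) D ⟨
    +ℤ ((a * D + b * D) * D)
      ≡⟨ cong +ℤ_ (distrib a b D) ⟩
    +ℤ ((a + b) * (D * D))
      ≡⟨ ZP.pos-* (a + b) (D * D) ⟩
    +ℤ (a + b) *ℤ +ℤ (D * D) ∎))))
  where
  open ≡-Reasoning
  D : ℕ
  D = suc d
  distrib : ∀ a b D → (a * D + b * D) * D ≡ (a + b) * (D * D)
  distrib = solve-∀

frac-* : ∀ a b d e → frac a d *ℚ frac b e ≡ frac (a * b) (d * e)
frac-* a b zero e = QP.*-zeroˡ (frac b e)
frac-* a b (suc d) zero rewrite NP.*-zeroʳ d = QP.*-zeroʳ (frac a (suc d))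
frac-* a b (suc d) (suc e) = frac-via-ℚᵘ (a * b) (e + d * suc e)
  (UP.≃-trans (QP.toℚᵘ-homo-* (frac a (suc d)) (frac b (suc e)))
  (UP.≃-trans (UP.*-cong (QP.toℚᵘ-fromℚᵘ (mkℚᵘ (+ℤ a) d)) (QP.toℚᵘ-fromℚᵘ (mkℚᵘ (+ℤ b) e)))
  (*≡* (cong (_*ℤ +ℤ (suc d * suc e)) (sym (ZP.pos-* a b))))))

sumℚ-frac : ∀ {a} {A : Set a} (xs : List A) (f : A → ℕ) d →
            sumℚ (map (λ x → frac (f x) d) xs) ≡ frac (∑ xs f) d
sumℚ-frac [] f d = sym (frac-0 d)
sumℚ-frac (x ∷ xs) f d = trans (cong (frac (f x) d +ℚ_) (sumℚ-frac xs f d)) (frac-+ (f x) (∑ xs f) d)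

expect-inverse : ∀ {a} {X : Set a} L (T : List X) (Z ρ : X → ℕ) → (∀ x → Z x * 2 ^ ρ x ≡ 2 ^ L) →
                 expect (λ x → frac 1 (Z x)) T ≡ frac (∑[ x ∈ T ] 2 ^ ρ x) (2 ^ L * length T)
expect-inverse L T Z ρ Z*2^ρ≡2^L = begin
  sumℚ (map (λ x → frac 1 (Z x)) T) *ℚ frac 1 (length T)
    ≡⟨ cong (_*ℚ frac 1 (length T)) (cong sumℚ (map-cong each T)) ⟩
  sumℚ (map (λ x → frac (2 ^ ρ x) (2 ^ L)) T) *ℚ frac 1 (length T)
    ≡⟨ cong (_*ℚ frac 1 (length T)) (sumℚ-frac T (λ x → 2 ^ ρ x) (2 ^ L)) ⟩
  frac (∑[ x ∈ T ] 2 ^ ρ x) (2 ^ L) *ℚ frac 1 (length T)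
    ≡⟨ frac-* (∑[ x ∈ T ] 2 ^ ρ x) 1 (2 ^ L) (length T) ⟩
  frac ((∑[ x ∈ T ] 2 ^ ρ x) * 1) (2 ^ L * length T)
    ≡⟨ cong (λ a → frac a (2 ^ L * length T)) (NP.*-identityʳ (∑[ x ∈ T ] 2 ^ ρ x)) ⟩
  frac (∑[ x ∈ T ] 2 ^ ρ x) (2 ^ L * length T) ∎
  where
  open ≡-Reasoning
  each : ∀ x → frac 1 (Z x) ≡ frac (2 ^ ρ x) (2 ^ L)
  each x = trans (frac-scale 1 (Z x) (2 ^ ρ x) (NP.m^n>0 2 (ρ x)))
                 (cong₂ frac (NP.*-identityʳ (2 ^ ρ x)) (trans (NP.*-comm (2 ^ ρ x) (Z x)) (Z*2^ρ≡2^L x)))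

∑-by-value : ∀ {a} {X : Set a} (g : ℕ → ℕ) N (T : List X) (ρ : X → ℕ) → (∀ x → ρ x < N) →
             ∑[ r ∈ upTo N ] g r * length (filter (λ x → ρ x N.≟ r) T) ≡ ∑[ x ∈ T ] g (ρ x)
∑-by-value g N T ρ ρ<N = begin
  ∑[ r ∈ upTo N ] g r * length (filter (λ x → ρ x N.≟ r) T)
    ≡⟨ ∑-cong (upTo N) (λ r → cong (g r *_) (length-filter (λ x → ρ x N.≟ r) T)) ⟩
  ∑[ r ∈ upTo N ] g r * (∑[ x ∈ T ] indicator x r)
    ≡⟨ ∑-cong (upTo N) (λ r → ∑-*ˡ (g r) T (λ x → indicator x r)) ⟩
  ∑[ r ∈ upTo N ] ∑[ x ∈ T ] g r * indicator x r
    ≡⟨ ∑-comm (upTo N) T (λ r x → g r * indicator x r) ⟩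
  ∑[ x ∈ T ] ∑[ r ∈ upTo N ] g r * indicator x r
    ≡⟨ ∑-cong T (λ x → ∑-indicator g (upTo⁺ N) (∈-upTo⁺ (ρ<N x))) ⟩
  ∑[ x ∈ T ] g (ρ x) ∎
  where
  open ≡-Reasoning
  indicator : _ → ℕ → ℕ
  indicator x r = toℕ (does (ρ x N.≟ r))

sum-by-rank : ∀ {X : Set} L (T : List X) (ρ : X → ℕ) → (∀ x → ρ x ≤ L) →
  sumℚ (map (λ r → frac 1 (2 ^ (L ∸ r)) *ℚ prob (λ x → ρ x N.≟ r) T) (upTo (suc L)))
  ≡ frac (∑[ x ∈ T ] 2 ^ ρ x) (2 ^ L * length T)
sum-by-rank L T ρ ρ≤L = begin
  sumℚ (map (λ r → frac 1 (2 ^ (L ∸ r)) *ℚ frac (c r) (length T)) (upTo (suc L)))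
    ≡⟨ cong sumℚ (map-cong-local (All.tabulate (λ r∈ → each (NP.≤-pred (∈-upTo⁻ r∈))))) ⟩
  sumℚ (map (λ r → frac (2 ^ r * c r) (2 ^ L * length T)) (upTo (suc L)))
    ≡⟨ sumℚ-frac (upTo (suc L)) (λ r → 2 ^ r * c r) (2 ^ L * length T) ⟩
  frac (∑[ r ∈ upTo (suc L) ] 2 ^ r * c r) (2 ^ L * length T)
    ≡⟨ cong (λ a → frac a (2 ^ L * length T)) (∑-by-value (2 ^_) (suc L) T ρ (λ x → s≤s (ρ≤L x))) ⟩
  frac (∑[ x ∈ T ] 2 ^ ρ x) (2 ^ L * length T) ∎
  where
  open ≡-Reasoning
  c : ℕ → ℕ
  c r = length (filter (λ x → ρ x N.≟ r) T)
  each : ∀ {r} → r ≤ L → frac 1 (2 ^ (L ∸ r)) *ℚ frac (c r) (length T) ≡ frac (2 ^ r * c r) (2 ^ L * length T)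
  each {r} r≤L = begin
    frac 1 (2 ^ (L ∸ r)) *ℚ frac (c r) (length T)
      ≡⟨ frac-* 1 (c r) (2 ^ (L ∸ r)) (length T) ⟩
    frac (1 * c r) (2 ^ (L ∸ r) * length T)
      ≡⟨ frac-scale (1 * c r) (2 ^ (L ∸ r) * length T) (2 ^ r) (NP.m^n>0 2 r) ⟩
    frac (2 ^ r * (1 * c r)) (2 ^ r * (2 ^ (L ∸ r) * length T))
      ≡⟨ cong₂ frac (cong (2 ^ r *_) (NP.*-identityˡ (c r))) (begin
           2 ^ r * (2 ^ (L ∸ r) * length T) ≡⟨ NP.*-assoc (2 ^ r) _ (length T) ⟨
           2 ^ r * 2 ^ (L ∸ r) * length T   ≡⟨ cong (_* length T) (NP.^-distribˡ-+-* 2 r (L ∸ r)) ⟨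
           2 ^ (r + (L ∸ r)) * length T     ≡⟨ cong (λ e → 2 ^ e * length T) (NP.m+[n∸m]≡n r≤L) ⟩
           2 ^ L * length T                 ∎) ⟩
    frac (2 ^ r * c r) (2 ^ L * length T) ∎

theorem2 : (k n L : ℕ) → 3 ≤ k → k ≤ n →
    (PSat n L k ≡ rankSum n L k) × (rankSum n L k ≡ EinvY n L k)
theorem2 k n L _ _ = trans satisfiable (sym by-rank) , trans by-rank (sym inverse)
  where
  T : List (Matrix L n)
  T = Mat L n k
  average : ℚ
  average = frac (∑[ A ∈ T ] 2 ^ rank A) (2 ^ L * length T)
  satisfiable : PSat n L k ≡ average
  satisfiable = cong₂ frac (count-satisfiable n L k) (length-Ω n L k)
  by-rank : rankSum n L k ≡ average
  by-rank = sum-by-rank L T rank rank≤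
  inverse : EinvY n L k ≡ average
  inverse = expect-inverse L T Y rank
    (λ A → trans (cong (_* 2 ^ rank A) (Y≡count-kernelᵀ A)) (count-kernelᵀ*2^rank A))
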